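{- Let $n\ge 2$ and $D\in\mathcal{D}_{n,1}\cup\mathcal{D}_{n,2}$. Then for every vertex $r$ of $D$, $D$ contains $n-2$ pairwise arc-disjoint out-branchings rooted at $r$.
   Context: Digraphs have no loops or parallel arcs. $\overleftrightarrow{K}_n$ is the complete digraph on $n$ vertices. An out-branching of $D$ is a spanning out-tree of $D$, i.e. a spanning oriented tree in which every vertex except the root has in-degree one. $\mathcal{D}_{n,1}$ (resp. $\mathcal{D}_{n,2}$) is the set of digraphs obtained from $\overleftrightarrow{K}_n$ by deleting an arc set $M$ such that the subdigraph formed by the arcs of $M$ is a union of vertex-disjoint directed cycles (cycles of length 2 allowed) which together cover all $n$ vertices (resp. exactly $n-1$ vertices). -}

module Defs where

open import Data.Nat using (ℕ; zero; suc; _∸_)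
open import Data.Fin using (Fin)
open import Data.Product using (Σ; ∃; _×_; _,_)
open import Data.Sum using (_⊎_)
open import Function using (_∘_)
open import Function.Definitions using (Injective)
open import Relation.Binary.PropositionalEquality using (_≡_; _≢_)
open import Relation.Nullary using (¬_)

Digraph : ℕ → Set₁
Digraph n = Fin n → Fin n → Set

-- The deleted arc set M is encoded by a permutation σ of Fin n:
-- M = { (u , σ u) | σ u ≢ u }.  The arcs of M form vertex-disjoint directed
-- cycles (of length ≥ 2); the covered vertices are exactly the non-fixed
-- points of σ.  Conversely every such union of disjoint cycles arises this way.
record CycleCover (n : ℕ) : Set where
  field
    σ     : Fin n → Fin n
    σ-inj : Injective _≡_ _≡_ σ

open CycleCover public

InM : ∀ {n} → CycleCover n → Fin n → Fin n → Set
InM C u v = (σ C u ≡ v) × (v ≢ u)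

Covered : ∀ {n} → CycleCover n → Fin n → Set
Covered C v = σ C v ≢ v

KnMinus : ∀ {n} → CycleCover n → Digraph n
KnMinus C u v = (u ≢ v) × ¬ InM C u v

CoversAll : ∀ {n} → CycleCover n → Set
CoversAll {n} C = (v : Fin n) → Covered C v

CoversAllButOne : ∀ {n} → CycleCover n → Set
CoversAllButOne {n} C =
  Σ (Fin n) λ x → ¬ Covered C x × ((y : Fin n) → ¬ Covered C y → y ≡ x)

In𝒟n1 : ∀ {n} → Digraph n → Set₁
In𝒟n1 {n} D = Σ (CycleCover n) λ C → CoversAll C × (D ≡ KnMinus C)

In𝒟n2 : ∀ {n} → Digraph n → Set₁
In𝒟n2 {n} D = Σ (CycleCover n) λ C → CoversAllButOne C × (D ≡ KnMinus C)

iter : ∀ {A : Set} → (A → A) → ℕ → A → A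
iter f zero    x = x
iter f (suc k) x = f (iter f k x)

-- An out-branching of D rooted at r, given by the tail ("parent") of the unique
-- arc entering each non-root vertex.  Its arc set is { (parent v , v) | v ≢ r }.
-- The root has in-degree 0, every other vertex in-degree 1, and every vertex
-- reaches r by following parents, so the arcs form a spanning out-tree.
record OutBranching {n} (D : Digraph n) (r : Fin n) : Set where
  field
    parent   : Fin n → Fin n
    arcInD   : (v : Fin n) → v ≢ r → D (parent v) v
    reachesR : (v : Fin n) → ∃ λ k → iter parent k v ≡ r

open OutBranching public

ArcOf : ∀ {n} {D : Digraph n} {r : Fin n} → OutBranching D r → Fin n → Fin n → Set
ArcOf {r = r} B u v = (v ≢ r) × (parent B v ≡ u)

ArcDisjoint : ∀ {n} {D : Digraph n} {r : Fin n} → OutBranching D r → OutBranching D r → Set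
ArcDisjoint {n} B₁ B₂ = (u v : Fin n) → ArcOf B₁ u v → ¬ ArcOf B₂ u v

-- Which vertices the cycles cover is irrelevant: the argument works for K_n minus the arcs
-- (u , σ u) of any permutation σ.  Pick a hub w ≢ r with σ r ∈ {r , w}.  Each of the n − 2
-- remaining vertices c is the centre of a star branching: r → c, c → v for every v ∉ {c , σ c},
-- and σ c hangs from w (from r when σ c = w).  The parent of any vertex determines c, so
-- distinct stars are arc-disjoint.
module Submission where

open import Defs
open import Data.Nat using (ℕ; _≤_; _∸_; suc; s≤s)
open import Data.Fin using (Fin; punchIn; punchOut; _≟_) renaming (zero to fzero)
open import Data.Fin.Properties using (punchIn-injective; punchInᵢ≢i; punchIn-punchOut)
open import Data.Product using (Σ; ∃; _,_; _×_; proj₁)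
open import Data.Sum using (_⊎_; inj₁; inj₂; [_,_])
open import Function using (_∘′_)
open import Data.Empty using (⊥-elim)
open import Relation.Nullary using (yes; no)
open import Relation.Binary.PropositionalEquality using (_≡_; _≢_; refl; sym; trans; cong; subst)

ArcDisjointOutBranchings : ∀ {n} → Digraph n → Fin n → ℕ → Set
ArcDisjointOutBranchings {n} D r k =
  Σ (Fin k → OutBranching D r) (λ B → (i j : Fin k) → i ≢ j → ArcDisjoint (B i) (B j))

KnMinus-arc : ∀ {n} (C : CycleCover n) {u v : Fin n} → u ≢ v → σ C u ≢ v → KnMinus C u v
KnMinus-arc C u≢v σu≢v = u≢v , λ uv∈M → σu≢v (proj₁ uv∈M)

module Stars {n : ℕ} (C : CycleCover n) {r w : Fin n}
             (w≢r : w ≢ r) (σr∈rw : σ C r ≡ r ⊎ σ C r ≡ w) where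

  record Centre : Set where
    constructor centre
    field
      vertex : Fin n
      ≢root  : vertex ≢ r
      ≢hub   : vertex ≢ w

  open Centre

  σr≢centre : (c : Centre) → σ C r ≢ vertex c
  σr≢centre c σr≡c = [ (λ σr≡r → ≢root c (trans (sym σr≡c) σr≡r))
                      , (λ σr≡w → ≢hub c (trans (sym σr≡c) σr≡w)) ] σr∈rw

  σr≢w : (c : Centre) → σ C (vertex c) ≡ w → σ C r ≢ w
  σr≢w c σc≡w σr≡w = ≢root c (σ-inj C (trans σc≡w (sym σr≡w)))

  starParent : Centre → Fin n → Fin n
  starParent c v with v ≟ vertex c
  ... | yes _ = r
  ... | no _ with v ≟ σ C (vertex c)
  ...   | no _ = vertex c
  ...   | yes _ with v ≟ w
  ...     | yes _ = r
  ...     | no _ = w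

  data StarView (c : Centre) (v : Fin n) : Fin n → Set where
    at-centre    : v ≡ vertex c → StarView c v r
    at-hub       : v ≢ vertex c → v ≡ σ C (vertex c) → v ≡ w → StarView c v r
    at-successor : v ≢ vertex c → v ≡ σ C (vertex c) → v ≢ w → StarView c v w
    elsewhere    : v ≢ vertex c → v ≢ σ C (vertex c) → StarView c v (vertex c)

  starView : (c : Centre) (v : Fin n) → StarView c v (starParent c v)
  starView c v with v ≟ vertex c
  ... | yes v≡c = at-centre v≡c
  ... | no v≢c with v ≟ σ C (vertex c)
  ...   | no v≢σc = elsewhere v≢c v≢σc
  ...   | yes v≡σc with v ≟ w
  ...     | yes v≡w = at-hub v≢c v≡σc v≡w
  ...     | no v≢w = at-successor v≢c v≡σc v≢w

  view-arc : {c : Centre} {v p : Fin n} → StarView c v p → KnMinus C p v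
  view-arc {c} (at-centre refl) = KnMinus-arc C (≢root c ∘′ sym) (σr≢centre c)
  view-arc {c} (at-hub _ σc≡v refl) = KnMinus-arc C (w≢r ∘′ sym) (σr≢w c (sym σc≡v))
  view-arc {c} (at-successor _ refl v≢w) =
    KnMinus-arc C (v≢w ∘′ sym) (λ σw≡σc → ≢hub c (sym (σ-inj C σw≡σc)))
  view-arc (elsewhere v≢c v≢σc) = KnMinus-arc C (v≢c ∘′ sym) (v≢σc ∘′ sym)

  starParent-arc : (c : Centre) (v : Fin n) → KnMinus C (starParent c v) v
  starParent-arc c v = view-arc (starView c v)

  view-at-centre : {c : Centre} {p : Fin n} → StarView c (vertex c) p → p ≡ r
  view-at-centre (at-centre _) = refl
  view-at-centre (at-hub c≢c _ _) = ⊥-elim (c≢c refl)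
  view-at-centre (at-successor c≢c _ _) = ⊥-elim (c≢c refl)
  view-at-centre (elsewhere c≢c _) = ⊥-elim (c≢c refl)

  starParent-centre : (c : Centre) → starParent c (vertex c) ≡ r
  starParent-centre c = view-at-centre (starView c (vertex c))

  view-at-hub : {c : Centre} {p : Fin n} → StarView c w p → p ≡ r ⊎ p ≡ vertex c
  view-at-hub {c} (at-centre w≡c) = ⊥-elim (≢hub c (sym w≡c))
  view-at-hub (at-hub _ _ _) = inj₁ refl
  view-at-hub (at-successor _ _ w≢w) = ⊥-elim (w≢w refl)
  view-at-hub (elsewhere _ _) = inj₂ refl

  starParent-reaches-root : (c : Centre) (v : Fin n) → ∃ λ k → iter (starParent c) k v ≡ r
  starParent-reaches-root c v with starParent c v in eq | starView c v
  ... | _ | at-centre _ = 1 , eq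
  ... | _ | at-hub _ _ _ = 1 , eq
  ... | _ | elsewhere _ _ = 2 , trans (cong (starParent c) eq) (starParent-centre c)
  ... | _ | at-successor _ _ _ with starParent c w in eq′ | view-at-hub (starView c w)
  ...   | _ | inj₁ refl = 2 , trans (cong (starParent c) eq) eq′
  ...   | _ | inj₂ refl =
          3 , trans (cong (starParent c) (trans (cong (starParent c) eq) eq′)) (starParent-centre c)

  view-root : {c : Centre} {v p : Fin n} → StarView c v p → p ≡ r →
              v ≡ vertex c ⊎ (v ≡ σ C (vertex c) × v ≡ w)
  view-root (at-centre v≡c) _ = inj₁ v≡c
  view-root (at-hub _ v≡σc v≡w) _ = inj₂ (v≡σc , v≡w)
  view-root (at-successor _ _ _) w≡r = ⊥-elim (w≢r w≡r)
  view-root {c} (elsewhere _ _) c≡r = ⊥-elim (≢root c c≡r)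

  view-hub : {c : Centre} {v p : Fin n} → StarView c v p → p ≡ w → v ≡ σ C (vertex c)
  view-hub (at-centre _) r≡w = ⊥-elim (w≢r (sym r≡w))
  view-hub (at-hub _ _ _) r≡w = ⊥-elim (w≢r (sym r≡w))
  view-hub (at-successor _ v≡σc _) _ = v≡σc
  view-hub {c} (elsewhere _ _) c≡w = ⊥-elim (≢hub c c≡w)

  view-other : {c : Centre} {v p : Fin n} → StarView c v p → p ≢ r → p ≢ w → p ≡ vertex c
  view-other (at-centre _) r≢r _ = ⊥-elim (r≢r refl)
  view-other (at-hub _ _ _) r≢r _ = ⊥-elim (r≢r refl)
  view-other (at-successor _ _ _) _ w≢w = ⊥-elim (w≢w refl)
  view-other (elsewhere _ _) _ _ = refl

  centre-determined : {c c′ : Centre} {v p : Fin n} → StarView c v p → StarView c′ v p →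
                      vertex c ≡ vertex c′
  centre-determined {c} {c′} {p = p} V V′ with p ≟ r | p ≟ w
  ... | no p≢r | no p≢w = trans (sym (view-other V p≢r p≢w)) (view-other V′ p≢r p≢w)
  ... | _ | yes p≡w = σ-inj C (trans (sym (view-hub V p≡w)) (view-hub V′ p≡w))
  ... | yes p≡r | no _ with view-root V p≡r | view-root V′ p≡r
  ...   | inj₁ v≡c | inj₁ v≡c′ = trans (sym v≡c) v≡c′
  ...   | inj₁ v≡c | inj₂ (_ , v≡w) = ⊥-elim (≢hub c (trans (sym v≡c) v≡w))
  ...   | inj₂ (_ , v≡w) | inj₁ v≡c′ = ⊥-elim (≢hub c′ (trans (sym v≡c′) v≡w))
  ...   | inj₂ (v≡σc , _) | inj₂ (v≡σc′ , _) = σ-inj C (trans (sym v≡σc) v≡σc′)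

  starParent-injective : (c c′ : Centre) (v : Fin n) →
                         starParent c v ≡ starParent c′ v → vertex c ≡ vertex c′
  starParent-injective c c′ v same =
    centre-determined (starView c v) (subst (StarView c′ v) (sym same) (starView c′ v))

  star : Centre → OutBranching (KnMinus C) r
  star c = record
    { parent   = starParent c
    ; arcInD   = λ v _ → starParent-arc c v
    ; reachesR = starParent-reaches-root c
    }

  stars-arcDisjoint : (c c′ : Centre) → vertex c ≢ vertex c′ → ArcDisjoint (star c) (star c′)
  stars-arcDisjoint c c′ c≢c′ u v (_ , pv≡u) (_ , p′v≡u) =
    c≢c′ (starParent-injective c c′ v (trans pv≡u (sym p′v≡u)))

hub : ∀ {m} (C : CycleCover (suc (suc m))) (r : Fin (suc (suc m))) →
      Σ (Fin (suc m)) λ w′ → σ C r ≡ r ⊎ σ C r ≡ punchIn r w′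
hub C r with σ C r ≟ r
... | yes σr≡r = fzero , inj₁ σr≡r
... | no σr≢r = punchOut (σr≢r ∘′ sym) , inj₂ (sym (punchIn-punchOut _))

KnMinus-arcDisjointOutBranchings : ∀ m (C : CycleCover (suc (suc m))) (r : Fin (suc (suc m))) →
                                   ArcDisjointOutBranchings (KnMinus C) r m
KnMinus-arcDisjointOutBranchings m C r with hub C r
... | w′ , σr∈rw = star ∘′ centreAt , λ i j i≢j →
        stars-arcDisjoint (centreAt i) (centreAt j)
          (i≢j ∘′ punchIn-injective w′ i j ∘′ punchIn-injective r _ _)
  where
  open Stars C (punchInᵢ≢i r w′) σr∈rw

  centreAt : Fin m → Centre
  centreAt i = centre (punchIn r (punchIn w′ i)) (punchInᵢ≢i r _)
                      (punchInᵢ≢i w′ i ∘′ punchIn-injective r _ _)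

lemma2p5 : (n : ℕ) → 2 ≤ n → (D : Digraph n) → In𝒟n1 D ⊎ In𝒟n2 D →
           (r : Fin n) →
           Σ (Fin (n ∸ 2) → OutBranching D r)
             (λ B → (i j : Fin (n ∸ 2)) → i ≢ j → ArcDisjoint (B i) (B j))
lemma2p5 (suc (suc m)) (s≤s (s≤s _)) _ (inj₁ (C , _ , refl)) r =
  KnMinus-arcDisjointOutBranchings m C r
lemma2p5 (suc (suc m)) (s≤s (s≤s _)) _ (inj₂ (C , _ , refl)) r =
  KnMinus-arcDisjointOutBranchings m C r
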